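{- Let $G$ be a finite group, $H$ a subgroup, and $S\subset G$ with $S\cap H$ symmetric. Let $A$ be the adjacency operator of $\mathcal{G}(G,H,S)$ acting on the space $\mathcal{L}(G)$ of complex-valued functions on $G$, and let $\lambda_H:H\to \mathrm{GL}(\mathcal{L}(G))$ be given by $(\lambda_H(h)f)(x)=f(h^{ -1}x)$. Then $\lambda_H(h)A=A\lambda_H(h)$ for every $h\in H$.
   Context: A subset $X\subset G$ is symmetric if $X^{ -1}=X$. The group-subgroup pair graph $\mathcal{G}(G,H,S)$ is the undirected graph with vertex set $G$ whose edges are exactly the pairs $\{h,hs\}$ with $h\in H$, $s\in S$. Its adjacency operator is $(Af)(x)=\sum_{y\sim x} f(y)$, the sum over vertices $y$ adjacent to $x$; explicitly $(Af)(y)=\sum_{s\in S}f(ys)$ for $y\in H$ and $(Af)(y)=\sum_{s\in S\cap Hy} f(ys^{ -1})$ for $y\in G\setminus H$. -}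

module Defs where

open import Level using (Level; 0ℓ)
open import Data.Nat using (ℕ; zero; suc)
open import Data.Fin using (Fin; zero; suc)
open import Relation.Binary.PropositionalEquality using (_≡_)
open import Relation.Nullary using (Dec; yes; no)
open import Relation.Unary using (Pred; Decidable; _∈_)
open import Algebra.Bundles using (CommutativeMonoid)
open import Algebra.Structures using (IsGroup)

record FiniteGroup : Set₁ where
  field
    n       : ℕ
    _∙_     : Fin n → Fin n → Fin n
    ε       : Fin n
    _⁻¹     : Fin n → Fin n
    isGroup : IsGroup _≡_ _∙_ ε _⁻¹
  infixl 7 _∙_
  infix 8 _⁻¹

record Subgroup (G : FiniteGroup) : Set₁ where
  open FiniteGroup G
  field
    mem    : Pred (Fin n) 0ℓ
    mem?   : Decidable mem
    ε-mem  : ε ∈ mem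
    ∙-mem  : ∀ {x y} → x ∈ mem → y ∈ mem → (x ∙ y) ∈ mem
    ⁻¹-mem : ∀ {x} → x ∈ mem → (x ⁻¹) ∈ mem

record Subset (G : FiniteGroup) : Set₁ where
  open FiniteGroup G
  field
    mem  : Pred (Fin n) 0ℓ
    mem? : Decidable mem

-- S ∩ H is symmetric: (S ∩ H)⁻¹ = S ∩ H (since H is a subgroup, it suffices
-- that s ∈ S ∩ H implies s⁻¹ ∈ S; we state the full closure for clarity).
SymmetricIn : (G : FiniteGroup) → Subgroup G → Subset G → Set
SymmetricIn G H S =
  ∀ s → Subset.mem S s → Subgroup.mem H s →
    Subset.mem S (s ⁻¹) × Subgroup.mem H (s ⁻¹)
  where open FiniteGroup G
        open import Data.Product using (_×_)

module _ {c ℓ : Level} (M : CommutativeMonoid c ℓ) where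
  open CommutativeMonoid M renaming (Carrier to R; _∙_ to _+_; ε to 0#)

  sumFin : ∀ {k} → (Fin k → R) → R
  sumFin {zero}  f = 0#
  sumFin {suc k} f = f zero + sumFin (λ i → f (suc i))

  sumWhere : ∀ {k} {P : Pred (Fin k) 0ℓ} → Decidable P → (Fin k → R) → R
  sumWhere P? f = sumFin (λ i → ite (P? i) (f i))
    where
      ite : ∀ {A : Set} → Dec A → R → R
      ite (yes _) r = r
      ite (no _)  _ = 0#

  module _ (G : FiniteGroup) (H : Subgroup G) (S : Subset G) where
    open FiniteGroup G using (n; _⁻¹) renaming (_∙_ to _·_)

    adjacency : (Fin n → R) → (Fin n → R)
    adjacency f y with Subgroup.mem? H y
    ... | yes _ = sumWhere (Subset.mem? S) (λ s → f (y · s))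
    ... | no  _ = sumWhere (λ s → inSHy s) (λ s → f (y · (s ⁻¹)))
      where
        open import Relation.Nullary.Decidable using (_×-dec_)
        open import Data.Product using (_×_)
        inSHy : ∀ s → Dec (Subset.mem S s × Subgroup.mem H (s · (y ⁻¹)))
        inSHy s = Subset.mem? S s ×-dec Subgroup.mem? H (s · (y ⁻¹))

    leftReg : Fin n → (Fin n → R) → (Fin n → R)
    leftReg h f x = f ((h ⁻¹) · x)

-- The adjacency operator only looks at y ∈ H or at the coset condition s y⁻¹ ∈ H,
-- and both are unchanged when y is replaced by h⁻¹ y with h ∈ H: membership in H
-- is invariant under multiplication by elements of H on either side, and
-- s (h⁻¹ y)⁻¹ = (s y⁻¹) h. Since moreover (h⁻¹ y) s = h⁻¹ (y s), the two sides
-- are sums of the same terms over the same index set.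
module Submission where

open import Defs
open import Level using (Level; 0ℓ)
open import Data.Nat using (zero; suc)
open import Data.Fin using (Fin; zero; suc)
open import Data.Product using (map₂)
open import Data.Empty using (⊥-elim)
open import Algebra.Bundles using (CommutativeMonoid; Group)
open import Relation.Nullary using (yes; no)
open import Relation.Unary using (Pred; Decidable)
open import Relation.Nullary.Decidable using (_×-dec_)
open import Relation.Binary.PropositionalEquality using (_≡_; cong; subst; sym; module ≡-Reasoning)
open import Function.Bundles using (_⇔_; mk⇔; Equivalence)

module _ {c ℓ : Level} (M : CommutativeMonoid c ℓ) where
  open CommutativeMonoid M renaming (Carrier to R)

  sumWhere-cong : ∀ {k} {P Q : Pred (Fin k) 0ℓ} (P? : Decidable P) (Q? : Decidable Q)
    {f g : Fin k → R} → (∀ i → P i ⇔ Q i) → (∀ i → f i ≈ g i) →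
    sumWhere M P? f ≈ sumWhere M Q? g
  sumWhere-cong {zero}  P? Q? P⇔Q f≈g = refl
  sumWhere-cong {suc k} P? Q? P⇔Q f≈g with P? zero | Q? zero
  ... | yes _ | yes _ = ∙-cong (f≈g zero) rest
    where rest = sumWhere-cong (λ i → P? (suc i)) (λ i → Q? (suc i)) (λ i → P⇔Q (suc i)) (λ i → f≈g (suc i))
  ... | no  _ | no  _ = ∙-cong refl rest
    where rest = sumWhere-cong (λ i → P? (suc i)) (λ i → Q? (suc i)) (λ i → P⇔Q (suc i)) (λ i → f≈g (suc i))
  ... | yes p | no ¬q = ⊥-elim (¬q (Equivalence.to (P⇔Q zero) p))
  ... | no ¬p | yes q = ⊥-elim (¬p (Equivalence.from (P⇔Q zero) q))

module _ (G : FiniteGroup) (H : Subgroup G) where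
  open FiniteGroup G
  open Subgroup H using (mem; ∙-mem; ⁻¹-mem)

  private
    group : Group 0ℓ 0ℓ
    group = record { isGroup = isGroup }

  open Group group using (assoc; inverseʳ; inverseˡ; identityˡ; identityʳ)
  open import Algebra.Properties.Group group using (⁻¹-anti-homo-∙; ⁻¹-involutive)
  open ≡-Reasoning

  ∙-memˡ⇔ : ∀ {g y} → mem g → mem (g ∙ y) ⇔ mem y
  ∙-memˡ⇔ {g} {y} g∈H = mk⇔ (λ gy∈H → subst mem g⁻¹gy≡y (∙-mem (⁻¹-mem g∈H) gy∈H)) (∙-mem g∈H)
    where
      g⁻¹gy≡y : g ⁻¹ ∙ (g ∙ y) ≡ y
      g⁻¹gy≡y = begin
        g ⁻¹ ∙ (g ∙ y)  ≡⟨ sym (assoc (g ⁻¹) g y) ⟩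
        g ⁻¹ ∙ g ∙ y    ≡⟨ cong (_∙ y) (inverseˡ g) ⟩
        ε ∙ y           ≡⟨ identityˡ y ⟩
        y               ∎

  ∙-memʳ⇔ : ∀ {g y} → mem g → mem (y ∙ g) ⇔ mem y
  ∙-memʳ⇔ {g} {y} g∈H = mk⇔ (λ yg∈H → subst mem ygg⁻¹≡y (∙-mem yg∈H (⁻¹-mem g∈H))) (λ y∈H → ∙-mem y∈H g∈H)
    where
      ygg⁻¹≡y : y ∙ g ∙ g ⁻¹ ≡ y
      ygg⁻¹≡y = begin
        y ∙ g ∙ g ⁻¹    ≡⟨ assoc y g (g ⁻¹) ⟩
        y ∙ (g ∙ g ⁻¹)  ≡⟨ cong (y ∙_) (inverseʳ g) ⟩
        y ∙ ε           ≡⟨ identityʳ y ⟩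
        y               ∎

  coset-translate : ∀ s h y → s ∙ (h ⁻¹ ∙ y) ⁻¹ ≡ s ∙ y ⁻¹ ∙ h
  coset-translate s h y = begin
    s ∙ (h ⁻¹ ∙ y) ⁻¹      ≡⟨ cong (s ∙_) (⁻¹-anti-homo-∙ (h ⁻¹) y) ⟩
    s ∙ (y ⁻¹ ∙ h ⁻¹ ⁻¹)   ≡⟨ cong (λ g → s ∙ (y ⁻¹ ∙ g)) (⁻¹-involutive h) ⟩
    s ∙ (y ⁻¹ ∙ h)         ≡⟨ sym (assoc s (y ⁻¹) h) ⟩
    s ∙ y ⁻¹ ∙ h           ∎

  coset-translate-mem⇔ : ∀ {h} s y → mem h → mem (s ∙ (h ⁻¹ ∙ y) ⁻¹) ⇔ mem (s ∙ y ⁻¹)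
  coset-translate-mem⇔ {h} s y h∈H rewrite coset-translate s h y = ∙-memʳ⇔ h∈H

  module _ {c ℓ : Level} (M : CommutativeMonoid c ℓ) (S : Subset G) where
    open CommutativeMonoid M using (_≈_; reflexive)

    leftReg-adjacency-comm : ∀ {h} → mem h → (f : Fin n → CommutativeMonoid.Carrier M) → ∀ x →
      leftReg M G H S h (adjacency M G H S f) x ≈ adjacency M G H S (leftReg M G H S h f) x
    leftReg-adjacency-comm {h} h∈H f x with Subgroup.mem? H (h ⁻¹ ∙ x) | Subgroup.mem? H x
    ... | yes _ | yes _ = sumWhere-cong M (Subset.mem? S) (Subset.mem? S)
          (λ _ → mk⇔ (λ s∈S → s∈S) (λ s∈S → s∈S))
          (λ s → reflexive (cong f (assoc (h ⁻¹) x s)))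
    ... | no  _ | no  _ = sumWhere-cong M
          (λ s → Subset.mem? S s ×-dec Subgroup.mem? H (s ∙ (h ⁻¹ ∙ x) ⁻¹))
          (λ s → Subset.mem? S s ×-dec Subgroup.mem? H (s ∙ x ⁻¹))
          (λ s → let e = coset-translate-mem⇔ s x h∈H
                 in mk⇔ (map₂ (Equivalence.to e)) (map₂ (Equivalence.from e)))
          (λ s → reflexive (cong f (assoc (h ⁻¹) x (s ⁻¹))))
    ... | yes h⁻¹x∈H | no x∉H = ⊥-elim (x∉H (Equivalence.to (∙-memˡ⇔ (⁻¹-mem h∈H)) h⁻¹x∈H))
    ... | no h⁻¹x∉H | yes x∈H = ⊥-elim (h⁻¹x∉H (Equivalence.from (∙-memˡ⇔ (⁻¹-mem h∈H)) x∈H))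

proposition3p10 : {c ℓ : Level} (M : CommutativeMonoid c ℓ)
    (G : FiniteGroup) (H : Subgroup G) (S : Subset G) →
    SymmetricIn G H S →
    (h : Fin (FiniteGroup.n G)) → Subgroup.mem H h →
    (f : Fin (FiniteGroup.n G) → CommutativeMonoid.Carrier M) →
    (x : Fin (FiniteGroup.n G)) →
    CommutativeMonoid._≈_ M
      (leftReg M G H S h (adjacency M G H S f) x)
      (adjacency M G H S (leftReg M G H S h f) x)
proposition3p10 M G H S _ h h∈H = leftReg-adjacency-comm G H M S h∈H
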